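{- Let $(P,\mathit{Act},\mathrm{bn},\to)$ be a nominal transition system with $|\mathrm{bn}(\ell)|\le1$ for every $\ell\in\mathit{Act}$, and let $\to_{[\mathsf{ch}]}$ be its translation. Then $\to_{[\mathsf{ch}]}$ is equivariant: if $p\to_{[\mathsf{ch}]}\langle a\rangle(\ell,p')$ then $\pi\cdot p\to_{[\mathsf{ch}]}\langle\pi(a)\rangle(\pi\cdot\ell,\pi\cdot p')$ for every permutation $\pi$.
   Context: Let $\mathbb{A}$ be a countably infinite set of atoms; permutations are bijections of $\mathbb{A}$ moving finitely many atoms, $(a\ b)$ transpositions. A nominal set is a set with a permutation action ($\iota\cdot s=s$, $(\pi_1\circ\pi_2)\cdot s=\pi_1\cdot(\pi_2\cdot s)$) whose elements are finitely supported; $\mathrm{supp}(s)$ is the least support; $s_1\#s_2$ iff supports are disjoint; products carry the componentwise action; equivariance means commuting with (or being closed under) all permutations. Atom abstraction: $\langle a\rangle s=\{(b,(b\ a)\cdot s)\mid b=a\text{ or }b\#s\}$, with $\pi\cdot\langle a\rangle s=\langle\pi(a)\rangle(\pi\cdot s)$; $[\mathbb{A}]S$ denotes the nominal set of abstractions. A nominal transition system $(P,\mathit{Act},\mathrm{bn},\to)$ consists of nominal sets $P$ (states) and $\mathit{Act}$ (actions), an equivariant function $\mathrm{bn}:\mathit{Act}\to\mathcal{P}_{\mathrm{fin}}(\mathbb{A})$ with $\mathrm{bn}(\ell)\subseteq\mathrm{supp}(\ell)$, and an equivariant relation ${\to}\subseteq P\times(\mathit{Act}\times P)$ satisfying alpha-conversion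 of residuals: if $a\in\mathrm{bn}(\ell)$, $b\#(\ell,p')$ and $p\to(\ell,p')$ then $p\to((a\ b)\cdot\ell,(a\ b)\cdot p')$. Its translation is the least relation ${\to_{[\mathsf{ch}]}}\subseteq P\times[\mathbb{A}](\mathit{Act}\times P)$ such that for all $p,\ell,p'$: if $p\to(\ell,p')$ then $p\to_{[\mathsf{ch}]}\langle a\rangle(\ell,p')$ for every atom $a$ with either ($\mathrm{bn}(\ell)=\emptyset$ and $a\#(\ell,p')$) or $\mathrm{bn}(\ell)=\{a\}$. -}

module Defs where

open import Level using (Level; _⊔_) renaming (suc to lsuc; zero to lzero)
open import Data.Nat using (ℕ; _≤_; _≟_)
open import Data.List using (List; []; _∷_; _++_)
open import Data.List.Membership.Propositional using (_∈_; _∉_)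
open import Data.List.Membership.Propositional.Properties using (∈-++⁺ˡ; ∈-++⁺ʳ)
open import Data.List.Relation.Unary.Any using (here; there)
open import Data.Product using (Σ; ∃; ∃-syntax; _×_; _,_; proj₁; proj₂)
open import Data.Sum using (_⊎_)
open import Relation.Nullary using (¬_; yes; no; contradiction)
open import Relation.Unary using (Pred; _≐_)
open import Relation.Binary.PropositionalEquality
  using (_≡_; _≢_; refl; sym; trans; cong; cong₂)
open import Function.Bundles using (_⇔_)

Atom : Set
Atom = ℕ

record Perm : Set where
  field
    fun      : Atom → Atom
    inv      : Atom → Atom
    inv-fun  : ∀ a → inv (fun a) ≡ a
    fun-inv  : ∀ a → fun (inv a) ≡ a
    moved    : List Atom
    fixes    : ∀ a → a ∉ moved → fun a ≡ a
open Perm public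

ι : Perm
ι = record { fun = λ a → a ; inv = λ a → a ; inv-fun = λ _ → refl
           ; fun-inv = λ _ → refl ; moved = [] ; fixes = λ _ _ → refl }

_∘ₚ_ : Perm → Perm → Perm
π₁ ∘ₚ π₂ = record
  { fun = λ a → fun π₁ (fun π₂ a)
  ; inv = λ a → inv π₂ (inv π₁ a)
  ; inv-fun = λ a → trans (cong (inv π₂) (inv-fun π₁ (fun π₂ a))) (inv-fun π₂ a)
  ; fun-inv = λ a → trans (cong (fun π₁) (fun-inv π₂ (inv π₁ a))) (fun-inv π₁ a)
  ; moved = moved π₁ ++ moved π₂
  ; fixes = λ a a∉ →
      trans (cong (fun π₁) (fixes π₂ a (λ a∈ → a∉ (∈-++⁺ʳ (moved π₁) a∈))))
            (fixes π₁ a (λ a∈ → a∉ (∈-++⁺ˡ a∈)))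
  }

swap : Atom → Atom → Atom → Atom
swap a b c with c ≟ a
... | yes _ = b
... | no _ with c ≟ b
...   | yes _ = a
...   | no _ = c

swap-a : ∀ a b → swap a b a ≡ b
swap-a a b with a ≟ a
... | yes _ = refl
... | no a≢a = contradiction refl a≢a

swap-b : ∀ a b → swap a b b ≡ a
swap-b a b with b ≟ a
... | yes b≡a = b≡a
... | no _ with b ≟ b
...   | yes _ = refl
...   | no b≢b = contradiction refl b≢b

swap-other : ∀ a b c → c ≢ a → c ≢ b → swap a b c ≡ c
swap-other a b c c≢a c≢b with c ≟ a
... | yes c≡a = contradiction c≡a c≢a
... | no _ with c ≟ b
...   | yes c≡b = contradiction c≡b c≢b
...   | no _ = refl

swap-inv : ∀ a b c → swap a b (swap a b c) ≡ c
swap-inv a b c with c ≟ a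
... | yes refl = swap-b c b
... | no c≢a with c ≟ b
...   | yes refl = swap-a a c
...   | no c≢b = swap-other a b c c≢a c≢b

⦅_∙_⦆ : Atom → Atom → Perm
⦅ a ∙ b ⦆ = record
  { fun = swap a b ; inv = swap a b
  ; inv-fun = swap-inv a b ; fun-inv = swap-inv a b
  ; moved = a ∷ b ∷ []
  ; fixes = λ c c∉ → swap-other a b c (λ e → c∉ (here e)) (λ e → c∉ (there (here e)))
  }

Supports : {X : Set} → (Perm → X → X) → List Atom → X → Set
Supports act A x = ∀ π → (∀ a → a ∈ A → fun π a ≡ a) → act π x ≡ x

-- a # x  (a ∉ supp x): the least support is the intersection of all finite
-- supports, so a ∉ supp x iff some finite support of x avoids a
Fresh : {X : Set} → (Perm → X → X) → Atom → X → Set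
Fresh act a x = ∃[ A ] (Supports act A x × a ∉ A)

record NominalSet : Set₁ where
  field
    Carrier  : Set
    _·_      : Perm → Carrier → Carrier
    act-id   : ∀ s → ι · s ≡ s
    act-comp : ∀ π₁ π₂ s → (π₁ ∘ₚ π₂) · s ≡ π₁ · (π₂ · s)
    fin-supp : ∀ s → ∃[ A ] Supports _·_ A s
open NominalSet public

_⊢_#_ : (S : NominalSet) → Atom → Carrier S → Set
S ⊢ a # s = Fresh (_·_ S) a s

_⊗_ : NominalSet → NominalSet → NominalSet
S ⊗ T = record
  { Carrier = Carrier S × Carrier T
  ; _·_ = λ π st → (_·_ S π (proj₁ st)) , (_·_ T π (proj₂ st))
  ; act-id = λ st → cong₂ _,_ (act-id S (proj₁ st)) (act-id T (proj₂ st))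
  ; act-comp = λ π₁ π₂ st →
      cong₂ _,_ (act-comp S π₁ π₂ (proj₁ st)) (act-comp T π₁ π₂ (proj₂ st))
  ; fin-supp = λ st →
      let (A , sA) = fin-supp S (proj₁ st)
          (B , sB) = fin-supp T (proj₂ st)
      in (A ++ B) , λ π fx →
           cong₂ _,_ (sA π (λ a a∈ → fx a (∈-++⁺ˡ a∈)))
                     (sB π (λ a a∈ → fx a (∈-++⁺ʳ A a∈)))
  }

⟨_⟩[_]_ : Atom → (S : NominalSet) → Carrier S → Pred (Atom × Carrier S) lzero
⟨ a ⟩[ S ] s = λ bt → (proj₁ bt ≡ a ⊎ S ⊢ proj₁ bt # s)
                      × proj₂ bt ≡ _·_ S ⦅ proj₁ bt ∙ a ⦆ s

record NTS (P Act : NominalSet) : Set₁ where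
  field
    bn          : Carrier Act → List Atom
    bn-equiv    : ∀ π ℓ b → (b ∈ bn (_·_ Act π ℓ)) ⇔ (∃[ a ] (a ∈ bn ℓ × fun π a ≡ b))
    bn-supp     : ∀ ℓ a → a ∈ bn ℓ → ¬ (Act ⊢ a # ℓ)
    _⟶_         : Carrier P → Carrier (Act ⊗ P) → Set
    ⟶-equiv     : ∀ π p ℓp' → p ⟶ ℓp' → _·_ P π p ⟶ _·_ (Act ⊗ P) π ℓp'
    alpha       : ∀ p ℓ p' a b → a ∈ bn ℓ → (Act ⊗ P) ⊢ b # (ℓ , p') →
                  p ⟶ (ℓ , p') → p ⟶ _·_ (Act ⊗ P) ⦅ a ∙ b ⦆ (ℓ , p')
open NTS public

AbsSet : NominalSet → NominalSet → Set₁
AbsSet P Act = Pred (Atom × Carrier (Act ⊗ P)) lzero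

-- The translation →[ch]: the least relation closed under the single rule
--   p → (ℓ,p'),  (bn ℓ = ∅ and a # (ℓ,p'))  or  bn ℓ = {a}
--   ⟹ p →[ch] ⟨a⟩(ℓ,p')
-- (the target is any set equal to ⟨a⟩(ℓ,p'), i.e. equality in [𝔸](Act × P))
data ChStep {P Act : NominalSet} (T : NTS P Act) (p : Carrier P)
            (α : AbsSet P Act) : Set₁ where
  ch : ∀ ℓ p' a →
       _⟶_ T p (ℓ , p') →
       ((∀ c → c ∉ bn T ℓ) × (Act ⊗ P) ⊢ a # (ℓ , p'))
         ⊎ (∀ c → (c ∈ bn T ℓ) ⇔ (c ≡ a)) →
       α ≐ ⟨ a ⟩[ Act ⊗ P ] (ℓ , p') →
       ChStep T p α

BnAtMostOne : {P Act : NominalSet} → NTS P Act → Set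
BnAtMostOne {Act = Act} T = ∀ ℓ a b → a ∈ bn T ℓ → b ∈ bn T ℓ → a ≡ b

-- A translated step p →[ch] ⟨a⟩x is witnessed by a transition p → x₀ with
-- binder a₀, and the equality of abstractions ⟨a⟩x = ⟨a₀⟩x₀ forces
-- x = (a₀ a)·x₀ with a = a₀ or a # x₀.  Alpha-conversion (or, when bn is
-- empty, the triviality of swapping two fresh atoms) then turns x₀ into x, so
-- every translated step is an instance of the rule at its own presentation.
-- Equivariance of →, bn and freshness transports such instances along π.

module Submission where

open import Defs
open import Data.Nat using (suc; _≟_)
open import Data.Nat.Properties using (1+n≰n)
open import Data.List using (List; _∷_; _++_; map)
open import Data.List.Extrema.Nat using (max; xs≤max)
open import Data.List.Membership.Propositional using (_∈_; _∉_)
open import Data.List.Membership.Propositional.Properties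
  using (∈-++⁺ˡ; ∈-++⁺ʳ; ∈-map⁺; ∈-map⁻)
open import Data.List.Relation.Unary.All as All using ()
open import Data.List.Relation.Unary.Any using (here; there)
open import Data.Product using (∃-syntax; _×_; _,_; proj₁; proj₂)
open import Data.Sum using (_⊎_; inj₁; inj₂)
open import Function using (id)
open import Function.Bundles using (_⇔_; mk⇔; Equivalence)
open import Relation.Nullary using (Dec; yes; no)
open import Relation.Unary using (_≐_)
open import Relation.Binary.PropositionalEquality
  using (_≡_; _≢_; refl; sym; trans; cong; subst; ≢-sym; module ≡-Reasoning)

open Equivalence using (to; from)

fresh-atom : (A : List Atom) → ∃[ c ] c ∉ A
fresh-atom A = suc (max 0 A) , λ c∈A → 1+n≰n (All.lookup (xs≤max 0 A) c∈A)

swap-self : ∀ a c → swap a a c ≡ c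
swap-self a c = by-cases (c ≟ a)
  where
  by-cases : Dec (c ≡ a) → swap a a c ≡ c
  by-cases (yes refl) = swap-a c c
  by-cases (no c≢a)   = swap-other a a c c≢a c≢a

swap-comm : ∀ a b c → swap a b c ≡ swap b a c
swap-comm a b c = by-cases (c ≟ a) (c ≟ b)
  where
  by-cases : Dec (c ≡ a) → Dec (c ≡ b) → swap a b c ≡ swap b a c
  by-cases (yes refl) _          = trans (swap-a c b) (sym (swap-b b c))
  by-cases (no _)     (yes refl) = trans (swap-b a c) (sym (swap-a c a))
  by-cases (no c≢a)   (no c≢b)   =
    trans (swap-other a b c c≢a c≢b) (sym (swap-other b a c c≢b c≢a))

swap-conjugate : ∀ {a b c} → a ≢ b → c ≢ a → c ≢ b →
                 ∀ d → swap a c (swap b c (swap a c d)) ≡ swap a b d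
swap-conjugate {a} {b} {c} a≢b c≢a c≢b d = by-cases (d ≟ a) (d ≟ b) (d ≟ c)
  where
  by-cases : Dec (d ≡ a) → Dec (d ≡ b) → Dec (d ≡ c) →
             swap a c (swap b c (swap a c d)) ≡ swap a b d
  by-cases (yes refl) _ _
    rewrite swap-a d c | swap-b b c | swap-other d c b (≢-sym a≢b) (≢-sym c≢b)
          | swap-a d b = refl
  by-cases (no d≢a) (yes refl) _
    rewrite swap-other a c d d≢a (≢-sym c≢b) | swap-a d c | swap-b a c
          | swap-b a d = refl
  by-cases (no d≢a) (no d≢b) (yes refl)
    rewrite swap-b a d | swap-other b d a a≢b (≢-sym c≢a) | swap-a a d
          | swap-other a b d d≢a d≢b = refl
  by-cases (no d≢a) (no d≢b) (no d≢c)
    rewrite swap-other a c d d≢a d≢c | swap-other b c d d≢b d≢c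
          | swap-other a c d d≢a d≢c | swap-other a b d d≢a d≢b = refl

_⁻¹ₚ : Perm → Perm
π ⁻¹ₚ = record
  { fun = inv π ; inv = fun π ; inv-fun = fun-inv π ; fun-inv = inv-fun π
  ; moved = moved π
  ; fixes = λ a a∉ → trans (cong (inv π) (sym (fixes π a a∉))) (inv-fun π a)
  }

fun-injective : ∀ π {a b} → fun π a ≡ fun π b → a ≡ b
fun-injective π {a} {b} πa≡πb =
  trans (sym (inv-fun π a)) (trans (cong (inv π) πa≡πb) (inv-fun π b))

module NominalSetProperties (S : NominalSet) where

  private
    infixr 5 _⋆_
    _⋆_ : Perm → Carrier S → Carrier S
    _⋆_ = _·_ S

  act-trivial : ∀ ρ x → (∀ c → fun ρ c ≡ c) → ρ ⋆ x ≡ x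
  act-trivial ρ x ρ≗id = proj₂ (fin-supp S x) ρ (λ c _ → ρ≗id c)

  act-inverseʳ : ∀ π x → π ⋆ (π ⁻¹ₚ) ⋆ x ≡ x
  act-inverseʳ π x =
    trans (sym (act-comp S π (π ⁻¹ₚ) x)) (act-trivial (π ∘ₚ (π ⁻¹ₚ)) x (fun-inv π))

  act-ext : ∀ σ τ x → (∀ c → fun σ c ≡ fun τ c) → σ ⋆ x ≡ τ ⋆ x
  act-ext σ τ x σ≗τ = begin
    σ ⋆ x                      ≡⟨ cong (σ ⋆_) σ⁻¹τ-fixes ⟨
    σ ⋆ (σ ⁻¹ₚ) ⋆ τ ⋆ x        ≡⟨ act-inverseʳ σ (τ ⋆ x) ⟩
    τ ⋆ x                      ∎
    where
    open ≡-Reasoning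
    σ⁻¹τ-fixes : (σ ⁻¹ₚ) ⋆ τ ⋆ x ≡ x
    σ⁻¹τ-fixes = trans (sym (act-comp S (σ ⁻¹ₚ) τ x))
      (act-trivial ((σ ⁻¹ₚ) ∘ₚ τ) x
        (λ c → trans (cong (inv σ) (sym (σ≗τ c))) (inv-fun σ c)))

  swap-act-self : ∀ a x → ⦅ a ∙ a ⦆ ⋆ x ≡ x
  swap-act-self a x = act-trivial ⦅ a ∙ a ⦆ x (swap-self a)

  swap-act-comm : ∀ a b x → ⦅ a ∙ b ⦆ ⋆ x ≡ ⦅ b ∙ a ⦆ ⋆ x
  swap-act-comm a b x = act-ext ⦅ a ∙ b ⦆ ⦅ b ∙ a ⦆ x (swap-comm a b)

  supports-equivariant : ∀ π A x → Supports _⋆_ A x →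
                         Supports _⋆_ (map (fun π) A) (π ⋆ x)
  supports-equivariant π A x A-supp σ σ-fixes = begin
    σ ⋆ π ⋆ x                       ≡⟨ act-comp S σ π x ⟨
    (σ ∘ₚ π) ⋆ x                    ≡⟨ act-inverseʳ π _ ⟨
    π ⋆ (π ⁻¹ₚ) ⋆ (σ ∘ₚ π) ⋆ x      ≡⟨ cong (π ⋆_) (act-comp S (π ⁻¹ₚ) (σ ∘ₚ π) x) ⟨
    π ⋆ ((π ⁻¹ₚ) ∘ₚ (σ ∘ₚ π)) ⋆ x   ≡⟨ cong (π ⋆_) (A-supp _ conjugate-fixes) ⟩
    π ⋆ x                           ∎
    where
    open ≡-Reasoning
    conjugate-fixes : ∀ a → a ∈ A → inv π (fun σ (fun π a)) ≡ a
    conjugate-fixes a a∈A =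
      trans (cong (inv π) (σ-fixes (fun π a) (∈-map⁺ (fun π) a∈A))) (inv-fun π a)

  fresh-equivariant : ∀ π a x → S ⊢ a # x → S ⊢ fun π a # (π ⋆ x)
  fresh-equivariant π a x (A , A-supp , a∉A) =
    map (fun π) A , supports-equivariant π A x A-supp , πa∉πA
    where
    πa∉πA : fun π a ∉ map (fun π) A
    πa∉πA πa∈πA with ∈-map⁻ (fun π) πa∈πA
    ... | b , b∈A , πa≡πb = a∉A (subst (_∈ A) (sym (fun-injective π πa≡πb)) b∈A)

  swap-act-supported : ∀ {A x} → Supports _⋆_ A x →
                       ∀ {a b} → a ∉ A → b ∉ A → ⦅ a ∙ b ⦆ ⋆ x ≡ x
  swap-act-supported {A} A-supp {a} {b} a∉A b∉A =
    A-supp ⦅ a ∙ b ⦆ (λ d d∈A →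
      swap-other a b d (λ d≡a → a∉A (subst (_∈ A) d≡a d∈A))
                       (λ d≡b → b∉A (subst (_∈ A) d≡b d∈A)))

  swap-act-fresh : ∀ a b x → S ⊢ a # x → S ⊢ b # x → ⦅ a ∙ b ⦆ ⋆ x ≡ x
  swap-act-fresh a b x (A , A-supp , a∉A) (B , B-supp , b∉B) = by-cases (a ≟ b)
    where
    open ≡-Reasoning
    -- a and b may be avoided by different supports, so pass through an atom c
    -- outside both: (a b) = (a c)(b c)(a c).
    through-fresh : ∀ c → c ∉ a ∷ b ∷ A ++ B → a ≢ b → ⦅ a ∙ b ⦆ ⋆ x ≡ x
    through-fresh c c∉ a≢b = begin
      ⦅ a ∙ b ⦆ ⋆ x         ≡⟨ act-ext ⦅ a ∙ b ⦆ acbcac x ab≗acbcac ⟩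
      acbcac ⋆ x            ≡⟨ act-comp S ac bcac x ⟩
      ac ⋆ bcac ⋆ x         ≡⟨ cong (ac ⋆_) (act-comp S bc ac x) ⟩
      ac ⋆ bc ⋆ ac ⋆ x      ≡⟨ cong (λ y → ac ⋆ bc ⋆ y) ac-fixes ⟩
      ac ⋆ bc ⋆ x           ≡⟨ cong (ac ⋆_) bc-fixes ⟩
      ac ⋆ x                ≡⟨ ac-fixes ⟩
      x                     ∎
      where
      ac bc bcac acbcac : Perm
      ac = ⦅ a ∙ c ⦆
      bc = ⦅ b ∙ c ⦆
      bcac = bc ∘ₚ ac
      acbcac = ac ∘ₚ bcac
      c≢a : c ≢ a
      c≢a c≡a = c∉ (here c≡a)
      c≢b : c ≢ b
      c≢b c≡b = c∉ (there (here c≡b))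
      ab≗acbcac : ∀ d → swap a b d ≡ fun acbcac d
      ab≗acbcac d = sym (swap-conjugate a≢b c≢a c≢b d)
      ac-fixes : ac ⋆ x ≡ x
      ac-fixes = swap-act-supported A-supp a∉A
                   (λ c∈A → c∉ (there (there (∈-++⁺ˡ c∈A))))
      bc-fixes : bc ⋆ x ≡ x
      bc-fixes = swap-act-supported B-supp b∉B
                   (λ c∈B → c∉ (there (there (∈-++⁺ʳ A c∈B))))
    by-cases : Dec (a ≡ b) → ⦅ a ∙ b ⦆ ⋆ x ≡ x
    by-cases (yes refl) = swap-act-self a x
    by-cases (no a≢b)   = through-fresh (proj₁ c-fresh) (proj₂ c-fresh) a≢b
      where c-fresh = fresh-atom (a ∷ b ∷ A ++ B)

  abstraction-≐⁻ : ∀ {a b x y} → ⟨ a ⟩[ S ] x ≐ ⟨ b ⟩[ S ] y →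
                   (a ≡ b ⊎ S ⊢ a # y) × x ≡ ⦅ a ∙ b ⦆ ⋆ y
  abstraction-≐⁻ {a} {x = x} (⊆ , _) with ⊆ {a , ⦅ a ∙ a ⦆ ⋆ x} (inj₁ refl , refl)
  ... | a≡b⊎a#y , x≡ = a≡b⊎a#y , trans (sym (swap-act-self a x)) x≡

open NominalSetProperties

module _ {P Act : NominalSet} (T : NTS P Act) where

  private
    AP = Act ⊗ P

  ChSide : Atom → Carrier AP → Set
  ChSide a x = ((∀ c → c ∉ bn T (proj₁ x)) × AP ⊢ a # x)
               ⊎ (∀ c → (c ∈ bn T (proj₁ x)) ⇔ (c ≡ a))

  bn-empty-equivariant : ∀ π ℓ → (∀ c → c ∉ bn T ℓ) → ∀ c → c ∉ bn T (_·_ Act π ℓ)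
  bn-empty-equivariant π ℓ bn≡∅ c c∈ with to (bn-equiv T π ℓ c) c∈
  ... | b , b∈ , _ = bn≡∅ b b∈

  bn-singleton-equivariant : ∀ π ℓ a → (∀ c → (c ∈ bn T ℓ) ⇔ (c ≡ a)) →
                             ∀ c → (c ∈ bn T (_·_ Act π ℓ)) ⇔ (c ≡ fun π a)
  bn-singleton-equivariant π ℓ a bn≡a c = mk⇔ ⊆-πa πa-∈
    where
    ⊆-πa : c ∈ bn T (_·_ Act π ℓ) → c ≡ fun π a
    ⊆-πa c∈ with to (bn-equiv T π ℓ c) c∈
    ... | b , b∈ , πb≡c = trans (sym πb≡c) (cong (fun π) (to (bn≡a b) b∈))
    πa-∈ : c ≡ fun π a → c ∈ bn T (_·_ Act π ℓ)
    πa-∈ refl = from (bn-equiv T π ℓ c) (a , from (bn≡a a) refl , refl)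

  ChSide-equivariant : ∀ π a x → ChSide a x → ChSide (fun π a) (_·_ AP π x)
  ChSide-equivariant π a (ℓ , _) (inj₁ (bn≡∅ , a#)) =
    inj₁ (bn-empty-equivariant π ℓ bn≡∅ , fresh-equivariant AP π a _ a#)
  ChSide-equivariant π a (ℓ , _) (inj₂ bn≡a) =
    inj₂ (bn-singleton-equivariant π ℓ a bn≡a)

  alpha-renaming : ∀ {p a₀ a x} → _⟶_ T p x → ChSide a₀ x → a ≡ a₀ ⊎ AP ⊢ a # x →
                   _⟶_ T p (_·_ AP ⦅ a₀ ∙ a ⦆ x)
  alpha-renaming {p} {a₀} {x = x} step _ (inj₁ refl) =
    subst (_⟶_ T p) (sym (swap-act-self AP a₀ x)) step
  alpha-renaming {p} {a₀} {a} {x} step (inj₁ (_ , a₀#)) (inj₂ a#) =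
    subst (_⟶_ T p) (sym (swap-act-fresh AP a₀ a x a₀# a#)) step
  alpha-renaming {p} {a₀} {a} {ℓ , p'} step (inj₂ bn≡a₀) (inj₂ a#) =
    alpha T p ℓ p' a₀ a (from (bn≡a₀ a₀) refl) a# step

  ch-inversion : ∀ {p a x} → ChStep T p (⟨ a ⟩[ AP ] x) → _⟶_ T p x × ChSide a x
  ch-inversion {p} {a} {x} (ch ℓ₀ p₀ a₀ step side abs≐)
    with abstraction-≐⁻ AP abs≐
  ... | a≡a₀⊎a# , x≡ = subst (λ y → _⟶_ T p y × ChSide a y) (sym x≡renamed)
    ( alpha-renaming step side a≡a₀⊎a#
    , subst (λ b → ChSide b (_·_ AP ⦅ a₀ ∙ a ⦆ (ℓ₀ , p₀))) (swap-a a₀ a)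
            (ChSide-equivariant ⦅ a₀ ∙ a ⦆ a₀ (ℓ₀ , p₀) side))
    where
    x≡renamed : x ≡ _·_ AP ⦅ a₀ ∙ a ⦆ (ℓ₀ , p₀)
    x≡renamed = trans x≡ (swap-act-comm AP a a₀ (ℓ₀ , p₀))

lemma7p2 : (P Act : NominalSet) (T : NTS P Act) → BnAtMostOne T →
    ∀ p ℓ p' a → ChStep T p (⟨ a ⟩[ Act ⊗ P ] (ℓ , p')) →
    ∀ π → ChStep T (_·_ P π p)
                   (⟨ fun π a ⟩[ Act ⊗ P ] (_·_ Act π ℓ , _·_ P π p'))
lemma7p2 P Act T _ p ℓ p' a step π with ch-inversion T step
... | transition , side =
  ch (_·_ Act π ℓ) (_·_ P π p') (fun π a)
     (⟶-equiv T π p (ℓ , p') transition)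
     (ChSide-equivariant T π a (ℓ , p') side)
     (id , id)
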